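{- For any positive integer $n$, $$\sum_{j=0}^{n-1}\binom{n}{j}(-1)^j\frac{H_{2j}-H_j}{2j+1}=\frac{4^n}{2(2n+1)\binom{2n}{n}}\sum_{k=1}^n\frac{\binom{2k}{k}}{k4^k}+\frac{(-1)^nH_n}{2n+1}-\frac{4^nH_n}{2(2n+1)\binom{2n}{n}}-\frac{(-1)^nH_{2n}}{2n+1}.$$
   Context: For $m\ge0$, $H_m=\sum_{0<k\le m}\frac1k$ denotes the $m$th harmonic number, with $H_0=0$. -}

module Defs where

open import Data.Nat as ℕ using (ℕ; zero; suc)
open import Data.Integer as ℤ using (+_)
open import Data.Rational using (ℚ; 0ℚ; 1ℚ; _+_; _*_; -_; _/_)

ι : ℕ → ℚ
ι n = (+ n) / 1

-- reciprocal of a natural number as a rational; only ever applied to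
-- nonzero arguments below (value at 0 is an irrelevant convention)
inv : ℕ → ℚ
inv zero    = 0ℚ
inv (suc m) = (+ 1) / suc m

Σ< : ℕ → (ℕ → ℚ) → ℚ
Σ< zero    f = 0ℚ
Σ< (suc n) f = Σ< n f + f n

H : ℕ → ℚ
H m = Σ< m (λ i → inv (suc i))

sgn : ℕ → ℚ
sgn zero    = 1ℚ
sgn (suc j) = - sgn j

-- Write Δ n g = Σ_{j≤n} C(n,j) (−1)ʲ g j, so that Δ (n+1) g = Δ n g − Δ n (g ∘ suc); the left-hand
-- side of the identity is Δ n f minus its j = n term, where f j = (H_{2j} − H_j)/(2j+1).
-- Multiplication by the index commutes with Δ up to a shift, so an affine weight a j + b relates
-- Δ (n+1) g to Δ n g.  The weights j + 1 and 2j + 1 evaluate Δ n of 1/(j+1) and of 1/(2j+1)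
-- (the latter is 4ⁿ/((2n+1) C(2n,n))); as H_{2j} − H_j grows by 1/(2j+1) − 1/(2j+2) they also
-- evaluate Δ (n+1) (H_{2j} − H_j).  The weight 2j + 1 applied to f then yields a first-order
-- recurrence for Δ n f, which, scaled by 2(2n+1) C(2n,n)/4ⁿ, telescopes to Σ_{1≤k≤n} C(2k,k)/(k 4ᵏ) − H_n.
module Submission where

open import Defs
open import Algebra.Bundles using (CommutativeMonoid)
open import Data.Maybe.Base using (Maybe; just; nothing)
open import Data.Nat as ℕ using (ℕ; zero; suc; NonZero)
import Data.Nat.Properties as ℕ
import Data.Nat.Tactic.RingSolver as ℕ-Solver
open import Data.Nat.Combinatorics
  using (_C_; nC1≡n; nCn≡1; nCk≡nC[n∸k]; k>n⇒nCk≡0; nCk+nC[k+1]≡[n+1]C[k+1])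
import Data.Integer as ℤ
import Data.Integer.Properties as ℤ
open import Data.Rational using (ℚ; 0ℚ; 1ℚ; _+_; _-_; _*_; -_; toℚᵘ)
open import Data.Rational.Properties
  using ( _≟_; +-*-commutativeRing; *-1-commutativeMonoid
        ; +-assoc; +-comm; +-identityʳ; +-inverseʳ; *-assoc; *-identityˡ; *-identityʳ
        ; toℚᵘ-injective; toℚᵘ-fromℚᵘ; toℚᵘ-homo-+; toℚᵘ-homo-* )
open import Algebra.Properties.CommutativeSemigroup (CommutativeMonoid.commutativeSemigroup *-1-commutativeMonoid)
  using (x∙yz≈y∙xz; xy∙z≈x∙zy) renaming (interchange to *-interchange)
import Data.Rational.Unnormalised as ℚᵘ
import Data.Rational.Unnormalised.Properties as ℚᵘ
open import Function using (_∘_)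
open import Level using (0ℓ)
open import Relation.Nullary using (yes; no)
open import Relation.Binary.PropositionalEquality
open import Tactic.RingSolver using (solve-∀)
open import Tactic.RingSolver.Core.AlmostCommutativeRing using (AlmostCommutativeRing; fromCommutativeRing)

C-absorption : ∀ n k → suc k ℕ.* (suc n C suc k) ≡ suc n ℕ.* (n C k)
C-absorption zero    zero    = refl
C-absorption zero    (suc k) =
  trans (cong (suc (suc k) ℕ.*_) (k>n⇒nCk≡0 {1} (ℕ.s≤s (ℕ.s≤s (ℕ.z≤n {k}))))) (ℕ.*-zeroʳ (suc (suc k)))
C-absorption (suc n) zero    =
  trans (ℕ.*-identityˡ (suc (suc n) C 1)) (trans (nC1≡n (suc (suc n))) (sym (ℕ.*-identityʳ (suc (suc n)))))
C-absorption (suc n) (suc k) = begin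
  suc (suc k) ℕ.* (suc (suc n) C suc (suc k))
    ≡⟨ cong (suc (suc k) ℕ.*_) (nCk+nC[k+1]≡[n+1]C[k+1] (suc n) (suc k)) ⟨
  suc (suc k) ℕ.* (X ℕ.+ Y)
    ≡⟨ split k X Y ⟩
  X ℕ.+ (suc k ℕ.* X ℕ.+ suc (suc k) ℕ.* Y)
    ≡⟨ cong (X ℕ.+_) (cong₂ ℕ._+_ (C-absorption n k) (C-absorption n (suc k))) ⟩
  X ℕ.+ (suc n ℕ.* (n C k) ℕ.+ suc n ℕ.* (n C suc k))
    ≡⟨ cong (X ℕ.+_) (ℕ.*-distribˡ-+ (suc n) (n C k) (n C suc k)) ⟨
  X ℕ.+ suc n ℕ.* (n C k ℕ.+ n C suc k)
    ≡⟨ cong (λ z → X ℕ.+ suc n ℕ.* z) (nCk+nC[k+1]≡[n+1]C[k+1] n k) ⟩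
  suc (suc n) ℕ.* X  ∎
  where
  open ≡-Reasoning
  X = suc n C suc k
  Y = suc n C suc (suc k)
  split : ∀ k x y → suc (suc k) ℕ.* (x ℕ.+ y) ≡ x ℕ.+ (suc k ℕ.* x ℕ.+ suc (suc k) ℕ.* y)
  split = ℕ-Solver.solve-∀

centralBinomial-suc : ∀ n → suc n ℕ.* ((2 ℕ.* suc n) C suc n) ≡ 2 ℕ.* (2 ℕ.* n ℕ.+ 1) ℕ.* ((2 ℕ.* n) C n)
centralBinomial-suc n = ℕ.*-cancelˡ-≡ _ _ (suc n) (begin
  suc n ℕ.* (suc n ℕ.* ((2 ℕ.* suc n) C suc n))
    ≡⟨ cong (λ k → suc n ℕ.* (suc n ℕ.* (k C suc n))) (ℕ.*-suc 2 n) ⟩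
  suc n ℕ.* (suc n ℕ.* (suc (suc m) C suc n))
    ≡⟨ cong (suc n ℕ.*_) (C-absorption (suc m) n) ⟩
  suc n ℕ.* (suc (suc m) ℕ.* (suc m C n))
    ≡⟨ swap (suc n) (suc (suc m)) (suc m C n) ⟩
  suc (suc m) ℕ.* (suc n ℕ.* (suc m C n))
    ≡⟨ cong (λ z → suc (suc m) ℕ.* (suc n ℕ.* z)) symmetry ⟩
  suc (suc m) ℕ.* (suc n ℕ.* (suc m C suc n))
    ≡⟨ cong (suc (suc m) ℕ.*_) (C-absorption m n) ⟩
  suc (suc m) ℕ.* (suc m ℕ.* (m C n))
    ≡⟨ regroup n (m C n) ⟩
  suc n ℕ.* (2 ℕ.* (2 ℕ.* n ℕ.+ 1) ℕ.* (m C n))  ∎)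
  where
  open ≡-Reasoning
  m = 2 ℕ.* n
  n≤1+m : n ℕ.≤ suc m
  n≤1+m = ℕ.m≤n⇒m≤1+n (ℕ.m≤m+n n (1 ℕ.* n))
  1+m∸n≡1+n : suc m ℕ.∸ n ≡ suc n
  1+m∸n≡1+n = trans (cong (λ z → suc (n ℕ.+ z) ℕ.∸ n) (ℕ.+-identityʳ n)) (ℕ.m+n∸n≡m (suc n) n)
  symmetry : suc m C n ≡ suc m C suc n
  symmetry = trans (nCk≡nC[n∸k] n≤1+m) (cong (suc m C_) 1+m∸n≡1+n)
  swap : ∀ a b c → a ℕ.* (b ℕ.* c) ≡ b ℕ.* (a ℕ.* c)
  swap = ℕ-Solver.solve-∀
  regroup : ∀ n c → suc (suc (2 ℕ.* n)) ℕ.* (suc (2 ℕ.* n) ℕ.* c)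
                  ≡ suc n ℕ.* (2 ℕ.* (2 ℕ.* n ℕ.+ 1) ℕ.* c)
  regroup = ℕ-Solver.solve-∀

2n+1≢0 : ∀ n → NonZero (2 ℕ.* n ℕ.+ 1)
2n+1≢0 n = ℕ.≢-nonZero (ℕ.m+1+n≢0 (2 ℕ.* n))

centralDenominator-nonZero : ∀ n .{{_ : NonZero ((2 ℕ.* n) C n)}} →
                             NonZero (2 ℕ.* (2 ℕ.* n ℕ.+ 1) ℕ.* ((2 ℕ.* n) C n))
centralDenominator-nonZero n =
  ℕ.m*n≢0 (2 ℕ.* (2 ℕ.* n ℕ.+ 1)) ((2 ℕ.* n) C n) {{ℕ.m*n≢0 2 (2 ℕ.* n ℕ.+ 1) {{_}} {{2n+1≢0 n}}}}

centralBinomial-nonZero : ∀ n → NonZero ((2 ℕ.* n) C n)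
centralBinomial-nonZero zero    = _
centralBinomial-nonZero (suc n) =
  ℕ.m*n≢0⇒n≢0 (suc n) {{subst NonZero (sym (centralBinomial-suc n)) denominator≢0}}
  where
  denominator≢0 = centralDenominator-nonZero n {{centralBinomial-nonZero n}}

ℚ-ring : AlmostCommutativeRing 0ℓ 0ℓ
ℚ-ring = fromCommutativeRing +-*-commutativeRing isZero
  where
  isZero : ∀ x → Maybe (0ℚ ≡ x)
  isZero x with 0ℚ ≟ x
  ... | yes 0≡x = just 0≡x
  ... | no  _   = nothing

ι-toℚᵘ : ∀ n → toℚᵘ (ι n) ℚᵘ.≃ ℚᵘ.mkℚᵘ (ℤ.+ n) 0
ι-toℚᵘ n = toℚᵘ-fromℚᵘ (ℚᵘ.mkℚᵘ (ℤ.+ n) 0)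

ι-+ : ∀ m n → ι (m ℕ.+ n) ≡ ι m + ι n
ι-+ m n = toℚᵘ-injective (begin
  toℚᵘ (ι (m ℕ.+ n))                         ≈⟨ ι-toℚᵘ (m ℕ.+ n) ⟩
  ℚᵘ.mkℚᵘ (ℤ.+ (m ℕ.+ n)) 0                  ≈⟨ ℚᵘ.*≡* (cong (ℤ._* ℤ.+ 1) numerators) ⟩
  ℚᵘ.mkℚᵘ (ℤ.+ m) 0 ℚᵘ.+ ℚᵘ.mkℚᵘ (ℤ.+ n) 0  ≈⟨ ℚᵘ.+-cong (ι-toℚᵘ m) (ι-toℚᵘ n) ⟨
  toℚᵘ (ι m) ℚᵘ.+ toℚᵘ (ι n)                 ≈⟨ toℚᵘ-homo-+ (ι m) (ι n) ⟨
  toℚᵘ (ι m + ι n)                           ∎)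
  where
  open ℚᵘ.≃-Reasoning
  numerators : ℤ.+ (m ℕ.+ n) ≡ ℤ.+ m ℤ.* ℤ.+ 1 ℤ.+ ℤ.+ n ℤ.* ℤ.+ 1
  numerators = trans (ℤ.pos-+ m n) (sym (cong₂ ℤ._+_ (ℤ.*-identityʳ (ℤ.+ m)) (ℤ.*-identityʳ (ℤ.+ n))))

ι-* : ∀ m n → ι (m ℕ.* n) ≡ ι m * ι n
ι-* m n = toℚᵘ-injective (begin
  toℚᵘ (ι (m ℕ.* n))                         ≈⟨ ι-toℚᵘ (m ℕ.* n) ⟩
  ℚᵘ.mkℚᵘ (ℤ.+ (m ℕ.* n)) 0                  ≈⟨ ℚᵘ.*≡* (cong (ℤ._* ℤ.+ 1) (ℤ.pos-* m n)) ⟩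
  ℚᵘ.mkℚᵘ (ℤ.+ m) 0 ℚᵘ.* ℚᵘ.mkℚᵘ (ℤ.+ n) 0  ≈⟨ ℚᵘ.*-cong (ι-toℚᵘ m) (ι-toℚᵘ n) ⟨
  toℚᵘ (ι m) ℚᵘ.* toℚᵘ (ι n)                 ≈⟨ toℚᵘ-homo-* (ι m) (ι n) ⟨
  toℚᵘ (ι m * ι n)                           ∎)
  where open ℚᵘ.≃-Reasoning

ι*inv≡1 : ∀ n .{{_ : NonZero n}} → ι n * inv n ≡ 1ℚ
ι*inv≡1 (suc n) = toℚᵘ-injective (begin
  toℚᵘ (ι (suc n) * inv (suc n))
    ≈⟨ toℚᵘ-homo-* (ι (suc n)) (inv (suc n)) ⟩
  toℚᵘ (ι (suc n)) ℚᵘ.* toℚᵘ (inv (suc n))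
    ≈⟨ ℚᵘ.*-cong (ι-toℚᵘ (suc n)) (toℚᵘ-fromℚᵘ (ℚᵘ.mkℚᵘ (ℤ.+ 1) n)) ⟩
  ℚᵘ.mkℚᵘ (ℤ.+ suc n) 0 ℚᵘ.* ℚᵘ.1/ ℚᵘ.mkℚᵘ (ℤ.+ suc n) 0
    ≈⟨ ℚᵘ.*-inverseʳ (ℚᵘ.mkℚᵘ (ℤ.+ suc n) 0) ⟩
  toℚᵘ 1ℚ  ∎)
  where open ℚᵘ.≃-Reasoning

ι-suc : ∀ n → ι (suc n) ≡ 1ℚ + ι n
ι-suc = ι-+ 1

inv-unique : ∀ n .{{_ : NonZero n}} {x} → ι n * x ≡ 1ℚ → x ≡ inv n
inv-unique n {x} nx≡1 = begin
  x                  ≡⟨ *-identityʳ x ⟨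
  x * 1ℚ             ≡⟨ cong (x *_) (ι*inv≡1 n) ⟨
  x * (ι n * inv n)  ≡⟨ rearrange x (ι n) (inv n) ⟩
  ι n * x * inv n    ≡⟨ cong (_* inv n) nx≡1 ⟩
  1ℚ * inv n         ≡⟨ *-identityˡ (inv n) ⟩
  inv n              ∎
  where
  open ≡-Reasoning
  rearrange : ∀ x a b → x * (a * b) ≡ a * x * b
  rearrange = solve-∀ ℚ-ring

inv-* : ∀ m n .{{_ : NonZero m}} .{{_ : NonZero n}} → inv (m ℕ.* n) ≡ inv m * inv n
inv-* m n = sym (inv-unique (m ℕ.* n) {{ℕ.m*n≢0 m n}} (begin
  ι (m ℕ.* n) * (inv m * inv n)  ≡⟨ cong (_* (inv m * inv n)) (ι-* m n) ⟩
  ι m * ι n * (inv m * inv n)    ≡⟨ *-interchange (ι m) (ι n) (inv m) (inv n) ⟩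
  (ι m * inv m) * (ι n * inv n)  ≡⟨ cong₂ _*_ (ι*inv≡1 m) (ι*inv≡1 n) ⟩
  1ℚ * 1ℚ                        ≡⟨⟩
  1ℚ                             ∎))
  where open ≡-Reasoning

ι*inv-cancelˡ : ∀ d m k .{{_ : NonZero d}} .{{_ : NonZero k}} → ι (d ℕ.* m) * inv (d ℕ.* k) ≡ ι m * inv k
ι*inv-cancelˡ d m k = begin
  ι (d ℕ.* m) * inv (d ℕ.* k)    ≡⟨ cong₂ _*_ (ι-* d m) (inv-* d k) ⟩
  ι d * ι m * (inv d * inv k)    ≡⟨ *-interchange (ι d) (ι m) (inv d) (inv k) ⟩
  (ι d * inv d) * (ι m * inv k)  ≡⟨ cong (_* (ι m * inv k)) (ι*inv≡1 d) ⟩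
  1ℚ * (ι m * inv k)             ≡⟨ *-identityˡ (ι m * inv k) ⟩
  ι m * inv k                    ∎
  where open ≡-Reasoning

Σ<-cong : ∀ n {f g : ℕ → ℚ} → (∀ j → f j ≡ g j) → Σ< n f ≡ Σ< n g
Σ<-cong zero    f≗g = refl
Σ<-cong (suc n) f≗g = cong₂ _+_ (Σ<-cong n f≗g) (f≗g n)

Σ<-suc-head : ∀ n (f : ℕ → ℚ) → Σ< (suc n) f ≡ f 0 + Σ< n (f ∘ suc)
Σ<-suc-head zero    f = +-comm 0ℚ (f 0)
Σ<-suc-head (suc n) f =
  trans (cong (_+ f (suc n)) (Σ<-suc-head n f)) (+-assoc (f 0) (Σ< n (f ∘ suc)) (f (suc n)))

Σ<-distrib-− : ∀ n (f g : ℕ → ℚ) → Σ< n (λ j → f j - g j) ≡ Σ< n f - Σ< n g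
Σ<-distrib-− zero    f g = refl
Σ<-distrib-− (suc n) f g =
  trans (cong (_+ (f n - g n)) (Σ<-distrib-− n f g)) (regroup (Σ< n f) (Σ< n g) (f n) (g n))
  where
  regroup : ∀ a b c d → a - b + (c - d) ≡ a + c - (b + d)
  regroup = solve-∀ ℚ-ring

-- Defined by the recurrence rather than by the alternating binomial sum; Δ-binomial recovers the sum.
Δ : ℕ → (ℕ → ℚ) → ℚ
Δ zero    g = g 0
Δ (suc n) g = Δ n g - Δ n (g ∘ suc)

Δ-cong : ∀ n {f g : ℕ → ℚ} → (∀ j → f j ≡ g j) → Δ n f ≡ Δ n g
Δ-cong zero    f≗g = f≗g 0
Δ-cong (suc n) f≗g = cong₂ _-_ (Δ-cong n f≗g) (Δ-cong n (f≗g ∘ suc))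

Δ-+ : ∀ n (f g : ℕ → ℚ) → Δ n (λ j → f j + g j) ≡ Δ n f + Δ n g
Δ-+ zero    f g = refl
Δ-+ (suc n) f g = trans (cong₂ _-_ (Δ-+ n f g) (Δ-+ n (f ∘ suc) (g ∘ suc)))
                        (regroup (Δ n f) (Δ n g) (Δ n (f ∘ suc)) (Δ n (g ∘ suc)))
  where
  regroup : ∀ a b c d → a + b - (c + d) ≡ (a - c) + (b - d)
  regroup = solve-∀ ℚ-ring

Δ-− : ∀ n (f g : ℕ → ℚ) → Δ n (λ j → f j - g j) ≡ Δ n f - Δ n g
Δ-− zero    f g = refl
Δ-− (suc n) f g = trans (cong₂ _-_ (Δ-− n f g) (Δ-− n (f ∘ suc) (g ∘ suc)))
                        (regroup (Δ n f) (Δ n g) (Δ n (f ∘ suc)) (Δ n (g ∘ suc)))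
  where
  regroup : ∀ a b c d → a - b - (c - d) ≡ (a - c) - (b - d)
  regroup = solve-∀ ℚ-ring

Δ-*ˡ : ∀ n c (f : ℕ → ℚ) → Δ n (λ j → c * f j) ≡ c * Δ n f
Δ-*ˡ zero    c f = refl
Δ-*ˡ (suc n) c f = trans (cong₂ _-_ (Δ-*ˡ n c f) (Δ-*ˡ n c (f ∘ suc)))
                         (factor c (Δ n f) (Δ n (f ∘ suc)))
  where
  factor : ∀ c a b → c * a - c * b ≡ c * (a - b)
  factor = solve-∀ ℚ-ring

Δ-const : ∀ n c → Δ (suc n) (λ _ → c) ≡ 0ℚ
Δ-const n c = +-inverseʳ (Δ n (λ _ → c))

Δ-mul-index : ∀ n (g : ℕ → ℚ) → Δ (suc n) (λ j → ι j * g j) ≡ - (ι (suc n) * Δ n (g ∘ suc))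
Δ-mul-index zero    g = base (g 0) (g 1)
  where
  base : ∀ a b → 0ℚ * a - 1ℚ * b ≡ - (1ℚ * b)
  base = solve-∀ ℚ-ring
Δ-mul-index (suc n) g = begin
  Δ (suc n) (λ j → ι j * g j) - Δ (suc n) (λ j → ι (suc j) * g′ j)
    ≡⟨ cong₂ _-_ (Δ-mul-index n g) (trans (Δ-cong (suc n) shift) (Δ-+ (suc n) (λ j → ι j * g′ j) g′)) ⟩
  - (s * Δ n g′) - (Δ (suc n) (λ j → ι j * g′ j) + Δ (suc n) g′)
    ≡⟨ cong (λ z → - (s * Δ n g′) - (z + Δ (suc n) g′)) (Δ-mul-index n g′) ⟩
  - (s * Δ n g′) - (- (s * Δ n (g′ ∘ suc)) + (Δ n g′ - Δ n (g′ ∘ suc)))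
    ≡⟨ regroup s (Δ n g′) (Δ n (g′ ∘ suc)) ⟩
  - ((1ℚ + s) * (Δ n g′ - Δ n (g′ ∘ suc)))
    ≡⟨ cong (λ z → - (z * Δ (suc n) g′)) (ι-suc (suc n)) ⟨
  - (ι (suc (suc n)) * Δ (suc n) g′)  ∎
  where
  open ≡-Reasoning
  g′ = g ∘ suc
  s = ι (suc n)
  shift : ∀ j → ι (suc j) * g′ j ≡ ι j * g′ j + g′ j
  shift j = trans (cong (_* g′ j) (ι-suc j)) (distrib (ι j) (g′ j))
    where
    distrib : ∀ a x → (1ℚ + a) * x ≡ a * x + x
    distrib = solve-∀ ℚ-ring
  regroup : ∀ s a b → - (s * a) - (- (s * b) + (a - b)) ≡ - ((1ℚ + s) * (a - b))
  regroup = solve-∀ ℚ-ring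

Δ-affine : ∀ a b n (g : ℕ → ℚ) →
  (a * ι (suc n) + b) * Δ (suc n) g ≡ a * ι (suc n) * Δ n g + Δ (suc n) (λ j → (a * ι j + b) * g j)
Δ-affine a b n g = begin
  (a * s + b) * (Δ n g - Δ n (g ∘ suc))
    ≡⟨ regroup a b s (Δ n g) (Δ n (g ∘ suc)) ⟩
  A + (a * - (s * Δ n (g ∘ suc)) + b * (Δ n g - Δ n (g ∘ suc)))
    ≡⟨ cong (λ z → A + (a * z + b * Δ (suc n) g)) (Δ-mul-index n g) ⟨
  A + (a * Δ (suc n) (λ j → ι j * g j) + b * Δ (suc n) g)
    ≡⟨ cong (A +_) (cong₂ _+_ (Δ-*ˡ (suc n) a (λ j → ι j * g j)) (Δ-*ˡ (suc n) b g)) ⟨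
  A + (Δ (suc n) (λ j → a * (ι j * g j)) + Δ (suc n) (λ j → b * g j))
    ≡⟨ cong (A +_) (Δ-+ (suc n) (λ j → a * (ι j * g j)) (λ j → b * g j)) ⟨
  A + Δ (suc n) (λ j → a * (ι j * g j) + b * g j)
    ≡⟨ cong (A +_) (Δ-cong (suc n) (λ j → distrib a b (ι j) (g j))) ⟩
  A + Δ (suc n) (λ j → (a * ι j + b) * g j)  ∎
  where
  open ≡-Reasoning
  s = ι (suc n)
  A = a * s * Δ n g
  regroup : ∀ a b s x y → (a * s + b) * (x - y) ≡ a * s * x + (a * - (s * y) + b * (x - y))
  regroup = solve-∀ ℚ-ring
  distrib : ∀ a b i x → a * (i * x) + b * x ≡ (a * i + b) * x
  distrib = solve-∀ ℚ-ring

Δ-recip-affine : ∀ a b n (g : ℕ → ℚ) → (∀ j → (a * ι j + b) * g j ≡ 1ℚ) →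
  (a * ι (suc n) + b) * Δ (suc n) g ≡ a * ι (suc n) * Δ n g
Δ-recip-affine a b n g recip = begin
  (a * ι (suc n) + b) * Δ (suc n) g              ≡⟨ Δ-affine a b n g ⟩
  A + Δ (suc n) (λ j → (a * ι j + b) * g j)      ≡⟨ cong (A +_) (Δ-cong (suc n) recip) ⟩
  A + Δ (suc n) (λ _ → 1ℚ)                       ≡⟨ cong (A +_) (Δ-const n 1ℚ) ⟩
  A + 0ℚ                                         ≡⟨ +-identityʳ A ⟩
  A                                              ∎
  where
  open ≡-Reasoning
  A = a * ι (suc n) * Δ n g

binomialTerm : ℕ → (ℕ → ℚ) → ℕ → ℚ
binomialTerm n g j = ι (n C j) * sgn j * g j

binomialTerm-pascal : ∀ n (g : ℕ → ℚ) j →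
  binomialTerm (suc n) g (suc j) ≡ binomialTerm n g (suc j) - binomialTerm n (g ∘ suc) j
binomialTerm-pascal n g j = begin
  ι (suc n C suc j) * - sgn j * g (suc j)
    ≡⟨ cong (λ c → ι c * - sgn j * g (suc j)) (nCk+nC[k+1]≡[n+1]C[k+1] n j) ⟨
  ι (n C j ℕ.+ n C suc j) * - sgn j * g (suc j)
    ≡⟨ cong (λ c → c * - sgn j * g (suc j)) (ι-+ (n C j) (n C suc j)) ⟩
  (ι (n C j) + ι (n C suc j)) * - sgn j * g (suc j)
    ≡⟨ regroup (ι (n C j)) (ι (n C suc j)) (sgn j) (g (suc j)) ⟩
  ι (n C suc j) * - sgn j * g (suc j) - ι (n C j) * sgn j * g (suc j)  ∎
  where
  open ≡-Reasoning
  regroup : ∀ a b σ x → (a + b) * - σ * x ≡ b * - σ * x - a * σ * x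
  regroup = solve-∀ ℚ-ring

-- The j = 0 terms of the two sides agree definitionally: n C 0 reduces to 1.
Σ<-binomialTerm-suc : ∀ n (g : ℕ → ℚ) → Σ< (suc (suc n)) (binomialTerm (suc n) g)
                        ≡ Σ< (suc n) (binomialTerm n g) - Σ< (suc n) (binomialTerm n (g ∘ suc))
Σ<-binomialTerm-suc n g = begin
  Σ< (suc (suc n)) (binomialTerm (suc n) g)
    ≡⟨ Σ<-suc-head (suc n) (binomialTerm (suc n) g) ⟩
  t 0 + Σ< (suc n) (λ j → binomialTerm (suc n) g (suc j))
    ≡⟨ cong (t 0 +_) (trans (Σ<-cong (suc n) (binomialTerm-pascal n g)) (Σ<-distrib-− (suc n) (t ∘ suc) t′)) ⟩
  t 0 + (Σ< (suc n) (t ∘ suc) - Σ< (suc n) t′)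
    ≡⟨ +-assoc (t 0) (Σ< (suc n) (t ∘ suc)) (- Σ< (suc n) t′) ⟨
  t 0 + Σ< (suc n) (t ∘ suc) - Σ< (suc n) t′
    ≡⟨ cong (_- Σ< (suc n) t′) (Σ<-suc-head (suc n) t) ⟨
  Σ< (suc n) t + t (suc n) - Σ< (suc n) t′
    ≡⟨ cong (λ c → Σ< (suc n) t + ι c * sgn (suc n) * g (suc n) - Σ< (suc n) t′)
            (k>n⇒nCk≡0 (ℕ.n<1+n n)) ⟩
  Σ< (suc n) t + 0ℚ * sgn (suc n) * g (suc n) - Σ< (suc n) t′
    ≡⟨ cong (_- Σ< (suc n) t′) (drop (Σ< (suc n) t) (sgn (suc n)) (g (suc n))) ⟩
  Σ< (suc n) t - Σ< (suc n) t′  ∎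
  where
  open ≡-Reasoning
  t = binomialTerm n g
  t′ = binomialTerm n (g ∘ suc)
  drop : ∀ a σ x → a + 0ℚ * σ * x ≡ a
  drop = solve-∀ ℚ-ring

Δ-binomial : ∀ n (g : ℕ → ℚ) → Δ n g ≡ Σ< (suc n) (binomialTerm n g)
Δ-binomial zero    g = base (g 0)
  where
  base : ∀ x → x ≡ 0ℚ + 1ℚ * 1ℚ * x
  base = solve-∀ ℚ-ring
Δ-binomial (suc n) g = begin
  Δ n g - Δ n (g ∘ suc)
    ≡⟨ cong₂ _-_ (Δ-binomial n g) (Δ-binomial n (g ∘ suc)) ⟩
  Σ< (suc n) (binomialTerm n g) - Σ< (suc n) (binomialTerm n (g ∘ suc))
    ≡⟨ Σ<-binomialTerm-suc n g ⟨
  Σ< (suc (suc n)) (binomialTerm (suc n) g)  ∎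
  where open ≡-Reasoning

Σ<-binomialTerm : ∀ n (g : ℕ → ℚ) → Σ< n (binomialTerm n g) ≡ Δ n g - sgn n * g n
Σ<-binomialTerm n g = begin
  Σ< n t
    ≡⟨ restore (Σ< n t) (sgn n) (g n) ⟩
  Σ< n t + 1ℚ * sgn n * g n - sgn n * g n
    ≡⟨ cong (λ c → Σ< n t + ι c * sgn n * g n - sgn n * g n) (nCn≡1 n) ⟨
  Σ< (suc n) t - sgn n * g n
    ≡⟨ cong (_- (sgn n * g n)) (Δ-binomial n g) ⟨
  Δ n g - sgn n * g n  ∎
  where
  open ≡-Reasoning
  t = binomialTerm n g
  restore : ∀ a σ x → a ≡ a + 1ℚ * σ * x - σ * x
  restore = solve-∀ ℚ-ring

γ : ℕ → ℚ
γ n = ι ((2 ℕ.* n) C n) * inv (4 ℕ.^ n)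

γ-suc : ∀ n → ι 2 * ι (suc n) * γ (suc n) ≡ ι (2 ℕ.* n ℕ.+ 1) * γ n
γ-suc n = begin
  ι 2 * ι (suc n) * (ι c′ * inv (4 ℕ.* q))    ≡⟨ cong (_* (ι c′ * inv (4 ℕ.* q))) (ι-* 2 (suc n)) ⟨
  ι (2 ℕ.* suc n) * (ι c′ * inv (4 ℕ.* q))    ≡⟨ *-assoc (ι (2 ℕ.* suc n)) (ι c′) (inv (4 ℕ.* q)) ⟨
  ι (2 ℕ.* suc n) * ι c′ * inv (4 ℕ.* q)      ≡⟨ cong (_* inv (4 ℕ.* q)) (ι-* (2 ℕ.* suc n) c′) ⟨
  ι (2 ℕ.* suc n ℕ.* c′) * inv (4 ℕ.* q)      ≡⟨ cong (λ m → ι m * inv (4 ℕ.* q)) c′-rec ⟩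
  ι (4 ℕ.* (o ℕ.* c)) * inv (4 ℕ.* q)         ≡⟨ ι*inv-cancelˡ 4 (o ℕ.* c) q ⟩
  ι (o ℕ.* c) * inv q                          ≡⟨ cong (_* inv q) (ι-* o c) ⟩
  ι o * ι c * inv q                            ≡⟨ *-assoc (ι o) (ι c) (inv q) ⟩
  ι o * γ n                                    ∎
  where
  open ≡-Reasoning
  o = 2 ℕ.* n ℕ.+ 1
  q = 4 ℕ.^ n
  c = (2 ℕ.* n) C n
  c′ = (2 ℕ.* suc n) C suc n
  instance _ = ℕ.m^n≢0 4 n
  c′-rec : 2 ℕ.* suc n ℕ.* c′ ≡ 4 ℕ.* (o ℕ.* c)
  c′-rec = trans (ℕ.*-assoc 2 (suc n) c′) (trans (cong (2 ℕ.*_) (centralBinomial-suc n)) (regroup o c))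
    where
    regroup : ∀ o c → 2 ℕ.* (2 ℕ.* o ℕ.* c) ≡ 4 ℕ.* (o ℕ.* c)
    regroup = ℕ-Solver.solve-∀

ι-odd : ∀ n → ι 2 * ι n + 1ℚ ≡ ι (2 ℕ.* n ℕ.+ 1)
ι-odd n = sym (trans (ι-+ (2 ℕ.* n) 1) (cong (_+ 1ℚ) (ι-* 2 n)))

inv-suc : ℕ → ℚ
inv-suc j = inv (suc j)

inv-odd : ℕ → ℚ
inv-odd j = inv (2 ℕ.* j ℕ.+ 1)

H-gap : ℕ → ℚ
H-gap j = H (2 ℕ.* j) - H j

ι-odd*inv-odd : ∀ j → (ι 2 * ι j + 1ℚ) * inv-odd j ≡ 1ℚ
ι-odd*inv-odd j = trans (cong (_* inv-odd j) (ι-odd j)) (ι*inv≡1 (2 ℕ.* j ℕ.+ 1) {{2n+1≢0 j}})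

Δ-inv-suc : ∀ n → Δ n inv-suc ≡ inv (suc n)
Δ-inv-suc zero    = refl
Δ-inv-suc (suc n) = inv-unique (suc (suc n)) (begin
  ι (suc (suc n)) * Δ (suc n) inv-suc        ≡⟨ cong (_* Δ (suc n) inv-suc) (ι-suc′ (suc n)) ⟨
  (1ℚ * ι (suc n) + 1ℚ) * Δ (suc n) inv-suc  ≡⟨ Δ-recip-affine 1ℚ 1ℚ n inv-suc ι-suc′*inv-suc ⟩
  1ℚ * ι (suc n) * Δ n inv-suc               ≡⟨ cong₂ _*_ (*-identityˡ (ι (suc n))) (Δ-inv-suc n) ⟩
  ι (suc n) * inv (suc n)                    ≡⟨ ι*inv≡1 (suc n) ⟩
  1ℚ                                         ∎)
  where
  open ≡-Reasoning
  ι-suc′ : ∀ m → 1ℚ * ι m + 1ℚ ≡ ι (suc m)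
  ι-suc′ m = trans (cong (_+ 1ℚ) (*-identityˡ (ι m))) (trans (+-comm (ι m) 1ℚ) (sym (ι-suc m)))
  ι-suc′*inv-suc : ∀ j → (1ℚ * ι j + 1ℚ) * inv-suc j ≡ 1ℚ
  ι-suc′*inv-suc j = trans (cong (_* inv-suc j) (ι-suc′ j)) (ι*inv≡1 (suc j))

Δ-inv-odd : ∀ n → ι (2 ℕ.* n ℕ.+ 1) * γ n * Δ n inv-odd ≡ 1ℚ
Δ-inv-odd zero    = refl
Δ-inv-odd (suc n) = begin
  ι (2 ℕ.* suc n ℕ.+ 1) * γ (suc n) * Δ (suc n) inv-odd
    ≡⟨ cong (λ x → x * γ (suc n) * Δ (suc n) inv-odd) (ι-odd (suc n)) ⟨
  (ι 2 * ι (suc n) + 1ℚ) * γ (suc n) * Δ (suc n) inv-odd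
    ≡⟨ swap (ι 2 * ι (suc n) + 1ℚ) (γ (suc n)) (Δ (suc n) inv-odd) ⟩
  γ (suc n) * ((ι 2 * ι (suc n) + 1ℚ) * Δ (suc n) inv-odd)
    ≡⟨ cong (γ (suc n) *_) (Δ-recip-affine (ι 2) 1ℚ n inv-odd ι-odd*inv-odd) ⟩
  γ (suc n) * (ι 2 * ι (suc n) * Δ n inv-odd)
    ≡⟨ swap (ι 2 * ι (suc n)) (γ (suc n)) (Δ n inv-odd) ⟨
  ι 2 * ι (suc n) * γ (suc n) * Δ n inv-odd
    ≡⟨ cong (_* Δ n inv-odd) (γ-suc n) ⟩
  ι (2 ℕ.* n ℕ.+ 1) * γ n * Δ n inv-odd
    ≡⟨ Δ-inv-odd n ⟩
  1ℚ ∎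
  where
  open ≡-Reasoning
  swap : ∀ a b c → a * b * c ≡ b * (a * c)
  swap = solve-∀ ℚ-ring

γ-suc*Δ-inv-odd : ∀ n → ι 2 * γ (suc n) * Δ n inv-odd ≡ inv (suc n)
γ-suc*Δ-inv-odd n = inv-unique (suc n) (begin
  ι (suc n) * (ι 2 * γ (suc n) * Δ n inv-odd)  ≡⟨ regroup (ι (suc n)) (ι 2) (γ (suc n)) (Δ n inv-odd) ⟩
  ι 2 * ι (suc n) * γ (suc n) * Δ n inv-odd    ≡⟨ cong (_* Δ n inv-odd) (γ-suc n) ⟩
  ι (2 ℕ.* n ℕ.+ 1) * γ n * Δ n inv-odd        ≡⟨ Δ-inv-odd n ⟩
  1ℚ                                           ∎)
  where
  open ≡-Reasoning
  regroup : ∀ s a g d → s * (a * g * d) ≡ a * s * g * d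
  regroup = solve-∀ ℚ-ring

H-gap-suc : ∀ j → H-gap (suc j) ≡ H-gap j + (inv-odd j - inv 2 * inv-suc j)
H-gap-suc j = begin
  H (2 ℕ.* suc j) - H (suc j)
    ≡⟨ cong (λ m → H m - H (suc j)) (ℕ.*-suc 2 j) ⟩
  H (2 ℕ.* j) + inv (suc (2 ℕ.* j)) + inv (suc (suc (2 ℕ.* j))) - (H j + inv-suc j)
    ≡⟨ cong₂ (λ a b → H (2 ℕ.* j) + inv a + inv b - (H j + inv-suc j))
             (ℕ.+-comm (2 ℕ.* j) 1) (ℕ.*-suc 2 j) ⟨
  H (2 ℕ.* j) + inv-odd j + inv (2 ℕ.* suc j) - (H j + inv-suc j)
    ≡⟨ cong (λ x → H (2 ℕ.* j) + inv-odd j + x - (H j + inv-suc j)) (inv-* 2 (suc j)) ⟩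
  H (2 ℕ.* j) + inv-odd j + inv 2 * inv-suc j - (H j + inv-suc j)
    ≡⟨ regroup (H (2 ℕ.* j)) (H j) (inv-odd j) (inv-suc j) ⟩
  H-gap j + (inv-odd j - inv 2 * inv-suc j)  ∎
  where
  open ≡-Reasoning
  regroup : ∀ a b u v → a + u + inv 2 * v - (b + v) ≡ (a - b) + (u - inv 2 * v)
  regroup = solve-∀ ℚ-ring

Δ-H-gap : ∀ n → Δ (suc n) H-gap ≡ inv 2 * Δ n inv-suc - Δ n inv-odd
Δ-H-gap n = begin
  Δ n H-gap - Δ n (H-gap ∘ suc)
    ≡⟨ cong (λ z → Δ n H-gap - z) (trans (Δ-cong n H-gap-suc) (Δ-+ n H-gap increment)) ⟩
  Δ n H-gap - (Δ n H-gap + Δ n increment)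
    ≡⟨ cong (λ z → Δ n H-gap - (Δ n H-gap + z)) (Δ-− n inv-odd (λ j → inv 2 * inv-suc j)) ⟩
  Δ n H-gap - (Δ n H-gap + (Δ n inv-odd - Δ n (λ j → inv 2 * inv-suc j)))
    ≡⟨ cong (λ z → Δ n H-gap - (Δ n H-gap + (Δ n inv-odd - z))) (Δ-*ˡ n (inv 2) inv-suc) ⟩
  Δ n H-gap - (Δ n H-gap + (Δ n inv-odd - inv 2 * Δ n inv-suc))
    ≡⟨ cancel (Δ n H-gap) (Δ n inv-odd) (inv 2 * Δ n inv-suc) ⟩
  inv 2 * Δ n inv-suc - Δ n inv-odd  ∎
  where
  open ≡-Reasoning
  increment = λ j → inv-odd j - inv 2 * inv-suc j
  cancel : ∀ a b c → a - (a + (b - c)) ≡ c - b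
  cancel = solve-∀ ℚ-ring

Δ-H-gap*inv-odd-suc : ∀ n → (ι 2 * ι (suc n) + 1ℚ) * Δ (suc n) (λ j → H-gap j * inv-odd j)
                            ≡ ι 2 * ι (suc n) * Δ n (λ j → H-gap j * inv-odd j)
                              + (inv 2 * Δ n inv-suc - Δ n inv-odd)
Δ-H-gap*inv-odd-suc n =
  trans (Δ-affine (ι 2) 1ℚ n f) (cong (ι 2 * ι (suc n) * Δ n f +_) (trans (Δ-cong (suc n) weighted) (Δ-H-gap n)))
  where
  f = λ j → H-gap j * inv-odd j
  weighted : ∀ j → (ι 2 * ι j + 1ℚ) * f j ≡ H-gap j
  weighted j = trans (x∙yz≈y∙xz (ι 2 * ι j + 1ℚ) (H-gap j) (inv-odd j))
                     (trans (cong (H-gap j *_) (ι-odd*inv-odd j)) (*-identityʳ (H-gap j)))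

Δ-H-gap*inv-odd-scaled : ∀ n → ι 2 * ι (2 ℕ.* n ℕ.+ 1) * γ n * Δ n (λ j → H-gap j * inv-odd j)
                               ≡ Σ< n (λ i → γ (suc i) * inv (suc i)) - H n
Δ-H-gap*inv-odd-scaled zero    = refl
Δ-H-gap*inv-odd-scaled (suc n) = begin
  ι 2 * ι (2 ℕ.* suc n ℕ.+ 1) * γ′ * Δ (suc n) f
    ≡⟨ cong (λ x → ι 2 * x * γ′ * Δ (suc n) f) (ι-odd (suc n)) ⟨
  ι 2 * (ι 2 * s + 1ℚ) * γ′ * Δ (suc n) f
    ≡⟨ regroup₁ (ι 2) (ι 2 * s + 1ℚ) γ′ (Δ (suc n) f) ⟩
  ι 2 * γ′ * ((ι 2 * s + 1ℚ) * Δ (suc n) f)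
    ≡⟨ cong (ι 2 * γ′ *_) (Δ-H-gap*inv-odd-suc n) ⟩
  ι 2 * γ′ * (ι 2 * s * Δ n f + (inv 2 * Δ n inv-suc - Δ n inv-odd))
    ≡⟨ regroup₂ (ι 2) (inv 2) s γ′ (Δ n f) (Δ n inv-suc) (Δ n inv-odd) ⟩
  ι 2 * (ι 2 * s * γ′) * Δ n f + ι 2 * inv 2 * (γ′ * Δ n inv-suc) - ι 2 * γ′ * Δ n inv-odd
    ≡⟨ cong₂ (λ x y → ι 2 * x * Δ n f + y - ι 2 * γ′ * Δ n inv-odd)
             (γ-suc n) (*-identityˡ (γ′ * Δ n inv-suc)) ⟩
  ι 2 * (ι (2 ℕ.* n ℕ.+ 1) * γ n) * Δ n f + γ′ * Δ n inv-suc - ι 2 * γ′ * Δ n inv-odd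
    ≡⟨ cong₂ (λ x y → x * Δ n f + γ′ * y - ι 2 * γ′ * Δ n inv-odd)
             (sym (*-assoc (ι 2) (ι (2 ℕ.* n ℕ.+ 1)) (γ n))) (Δ-inv-suc n) ⟩
  ι 2 * ι (2 ℕ.* n ℕ.+ 1) * γ n * Δ n f + γ′ * inv (suc n) - ι 2 * γ′ * Δ n inv-odd
    ≡⟨ cong₂ (λ x y → x + γ′ * inv (suc n) - y) (Δ-H-gap*inv-odd-scaled n) (γ-suc*Δ-inv-odd n) ⟩
  Σ< n t - H n + γ′ * inv (suc n) - inv (suc n)
    ≡⟨ regroup₃ (Σ< n t) (H n) (γ′ * inv (suc n)) (inv (suc n)) ⟩
  Σ< n t + γ′ * inv (suc n) - (H n + inv (suc n))  ∎
  where
  open ≡-Reasoning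
  f = λ j → H-gap j * inv-odd j
  t = λ i → γ (suc i) * inv (suc i)
  s = ι (suc n)
  γ′ = γ (suc n)
  regroup₁ : ∀ a b g d → a * b * g * d ≡ a * g * (b * d)
  regroup₁ = solve-∀ ℚ-ring
  regroup₂ : ∀ a i s g x y z → a * g * (a * s * x + (i * y - z))
                               ≡ a * (a * s * g) * x + a * i * (g * y) - a * g * z
  regroup₂ = solve-∀ ℚ-ring
  regroup₃ : ∀ a b c d → a - b + c - d ≡ a + c - (b + d)
  regroup₃ = solve-∀ ℚ-ring

Δ-H-gap*inv-odd : ∀ n → Δ n (λ j → H-gap j * inv-odd j)
                        ≡ ι (4 ℕ.^ n) * inv (2 ℕ.* (2 ℕ.* n ℕ.+ 1) ℕ.* ((2 ℕ.* n) C n))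
                          * (Σ< n (λ i → γ (suc i) * inv (suc i)) - H n)
Δ-H-gap*inv-odd n = begin
  Δ n f                     ≡⟨ *-identityˡ (Δ n f) ⟨
  1ℚ * Δ n f                ≡⟨ cong (_* Δ n f) c*k≡1 ⟨
  c * k * Δ n f             ≡⟨ *-assoc c k (Δ n f) ⟩
  c * (k * Δ n f)           ≡⟨ cong (c *_) (Δ-H-gap*inv-odd-scaled n) ⟩
  c * (Σ< n t - H n)        ∎
  where
  open ≡-Reasoning
  f = λ j → H-gap j * inv-odd j
  t = λ i → γ (suc i) * inv (suc i)
  o = 2 ℕ.* n ℕ.+ 1
  b = (2 ℕ.* n) C n
  D = 2 ℕ.* o ℕ.* b
  c = ι (4 ℕ.^ n) * inv D
  k = ι 2 * ι o * γ n
  instance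
    _ = centralBinomial-nonZero n
    _ = centralDenominator-nonZero n
    _ = ℕ.m^n≢0 4 n
  k≡ι*inv : k ≡ ι D * inv (4 ℕ.^ n)
  k≡ι*inv = trans (sym (*-assoc (ι 2 * ι o) (ι b) (inv (4 ℕ.^ n))))
                  (cong (_* inv (4 ℕ.^ n)) (sym (trans (ι-* (2 ℕ.* o) b) (cong (_* ι b) (ι-* 2 o)))))
  c*k≡1 : c * k ≡ 1ℚ
  c*k≡1 = begin
    c * k                                        ≡⟨ cong (c *_) k≡ι*inv ⟩
    ι (4 ℕ.^ n) * inv D * (ι D * inv (4 ℕ.^ n))  ≡⟨ regroup (ι (4 ℕ.^ n)) (inv D) (ι D) (inv (4 ℕ.^ n)) ⟩
    ι D * inv D * (ι (4 ℕ.^ n) * inv (4 ℕ.^ n))  ≡⟨ cong₂ _*_ (ι*inv≡1 D) (ι*inv≡1 (4 ℕ.^ n)) ⟩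
    1ℚ * 1ℚ                                      ≡⟨⟩
    1ℚ                                           ∎
    where
    regroup : ∀ a b c d → a * b * (c * d) ≡ c * b * (a * d)
    regroup = solve-∀ ℚ-ring

lemma2p1 : (n : ℕ) → ℕ.NonZero n →
    Σ< n (λ j → ι (n C j) * sgn j * (H (2 ℕ.* j) - H j) * inv (2 ℕ.* j ℕ.+ 1))
      ≡ ι (4 ℕ.^ n) * inv (2 ℕ.* (2 ℕ.* n ℕ.+ 1) ℕ.* ((2 ℕ.* n) C n))
          * Σ< n (λ i → ι ((2 ℕ.* suc i) C suc i) * inv (suc i ℕ.* 4 ℕ.^ suc i))
        + sgn n * H n * inv (2 ℕ.* n ℕ.+ 1)
        - ι (4 ℕ.^ n) * H n * inv (2 ℕ.* (2 ℕ.* n ℕ.+ 1) ℕ.* ((2 ℕ.* n) C n))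
        - sgn n * H (2 ℕ.* n) * inv (2 ℕ.* n ℕ.+ 1)
lemma2p1 n _ = begin
  Σ< n (λ j → ι (n C j) * sgn j * H-gap j * inv-odd j)
    ≡⟨ Σ<-cong n (λ j → *-assoc (ι (n C j) * sgn j) (H-gap j) (inv-odd j)) ⟩
  Σ< n (binomialTerm n f)
    ≡⟨ Σ<-binomialTerm n f ⟩
  Δ n f - sgn n * f n
    ≡⟨ cong (_- (sgn n * f n)) (Δ-H-gap*inv-odd n) ⟩
  F * I * (Σ< n t - H n) - sgn n * f n
    ≡⟨ cong (λ T → F * I * (T - H n) - sgn n * f n) (Σ<-cong n γ-term) ⟩
  F * I * (Σ< n t′ - H n) - sgn n * f n
    ≡⟨ expand F I (Σ< n t′) (H n) (sgn n) (H (2 ℕ.* n)) (inv-odd n) ⟩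
  F * I * Σ< n t′ + sgn n * H n * inv-odd n - F * H n * I - sgn n * H (2 ℕ.* n) * inv-odd n  ∎
  where
  open ≡-Reasoning
  f = λ j → H-gap j * inv-odd j
  t = λ i → γ (suc i) * inv (suc i)
  t′ = λ i → ι ((2 ℕ.* suc i) C suc i) * inv (suc i ℕ.* 4 ℕ.^ suc i)
  F = ι (4 ℕ.^ n)
  I = inv (2 ℕ.* (2 ℕ.* n ℕ.+ 1) ℕ.* ((2 ℕ.* n) C n))
  γ-term : ∀ i → t i ≡ t′ i
  γ-term i = trans (xy∙z≈x∙zy (ι ((2 ℕ.* suc i) C suc i)) (inv (4 ℕ.^ suc i)) (inv (suc i)))
                   (cong (ι ((2 ℕ.* suc i) C suc i) *_)
                         (sym (inv-* (suc i) (4 ℕ.^ suc i) {{_}} {{ℕ.m^n≢0 4 (suc i)}})))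
  expand : ∀ F I T Hn σ H2n u → F * I * (T - Hn) - σ * ((H2n - Hn) * u)
                                ≡ F * I * T + σ * Hn * u - F * Hn * I - σ * H2n * u
  expand = solve-∀ ℚ-ring
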